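{- Let $G$ be a finite bipartite graph. Then $\alpha(G)=a(G)$ if and only if $\alpha'(G)=a(G)$.
   Context: All graphs are finite and simple. $\alpha(G)$ denotes the independence number of $G$. For a set $S$ of vertices, $\mathcal{N}(S)$ denotes the set of vertices adjacent to at least one vertex of $S$. An independent set $I$ is critical if $|I|-|\mathcal{N}(I)|$ is maximum among all independent sets of $G$; the critical independence number $\alpha'(G)$ is the maximum cardinality of a critical independent set. The annihilation number $a(G)$: if $d_1\leq \dots\leq d_n$ are the vertex degrees of $G$ in nondecreasing order, $a(G)$ is the largest $k$ such that $\sum_{i=1}^k d_i\leq |E(G)|$. -}

module Defs where

open import Data.Bool using (Bool; true; false; _∧_; not)
open import Data.Nat using (ℕ; zero; suc; _+_; _*_; _⊔_; _≤ᵇ_; _<ᵇ_)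
open import Data.Nat.Properties using (≤-decTotalOrder)
open import Data.Integer as ℤ using (ℤ; _-_; +_)
open import Data.Fin using (Fin; toℕ)
open import Data.Fin.Subset using (Subset; ∣_∣)
open import Data.Vec using (Vec; []; _∷_; lookup; tabulate)
open import Data.List using (List; []; _∷_; _++_; map; foldr; take; filterᵇ; length; allFin; upTo)
open import Data.Nat.ListAction using (sum)
open import Data.Bool.ListAction using (any; all)
open import Relation.Nullary.Decidable using (⌊_⌋)
open import Data.Product using (Σ)
open import Relation.Binary.PropositionalEquality using (_≡_)
open import Data.List.Sort.InsertionSort ≤-decTotalOrder using (sort)

record Graph (n : ℕ) : Set where
  field
    adj    : Fin n → Fin n → Bool
    sym    : ∀ u v → adj u v ≡ adj v u
    irrefl : ∀ v → adj v v ≡ false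
open Graph public

Bipartite : ∀ {n} → Graph n → Set
Bipartite {n} G =
  Σ (Fin n → Bool) λ c → ∀ u v → adj G u v ≡ true → c u ≡ not (c v)

allSubsets : (n : ℕ) → List (Subset n)
allSubsets zero    = [] ∷ []
allSubsets (suc n) =
  map (true ∷_) (allSubsets n) ++ map (false ∷_) (allSubsets n)

isIndependent : ∀ {n} → Graph n → Subset n → Bool
isIndependent {n} G I =
  all (λ u → all (λ v → not (lookup I u ∧ lookup I v ∧ adj G u v))
                 (allFin n))
      (allFin n)

independentSets : ∀ {n} → Graph n → List (Subset n)
independentSets {n} G = filterᵇ (isIndependent G) (allSubsets n)

nbhd : ∀ {n} → Graph n → Subset n → Subset n
nbhd {n} G S = tabulate λ v → any (λ u → lookup S u ∧ adj G u v) (allFin n)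

maxℕ : List ℕ → ℕ
maxℕ = foldr _⊔_ 0

α : ∀ {n} → Graph n → ℕ
α G = maxℕ (map ∣_∣ (independentSets G))

diff : ∀ {n} → Graph n → Subset n → ℤ
diff G I = + ∣ I ∣ - + ∣ nbhd G I ∣

-- maximum of |I| - |𝒩(I)| over independent sets I.  The empty set is
-- independent with difference 0, so starting the fold at 0 is harmless.
maxDiff : ∀ {n} → Graph n → ℤ
maxDiff G = foldr ℤ._⊔_ (+ 0) (map (diff G) (independentSets G))

isCritical : ∀ {n} → Graph n → Subset n → Bool
isCritical G I = isIndependent G I ∧ ⌊ diff G I ℤ.≟ maxDiff G ⌋

α′ : ∀ {n} → Graph n → ℕ
α′ {n} G = maxℕ (map ∣_∣ (filterᵇ (isCritical G) (allSubsets n)))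

degree : ∀ {n} → Graph n → Fin n → ℕ
degree {n} G v = length (filterᵇ (adj G v) (allFin n))

edgeCount : ∀ {n} → Graph n → ℕ
edgeCount {n} G =
  sum (map (λ u → length (filterᵇ (λ v → (toℕ u <ᵇ toℕ v) ∧ adj G u v)
                                  (allFin n)))
           (allFin n))

sortedDegrees : ∀ {n} → Graph n → List ℕ
sortedDegrees {n} G = sort (map (degree G) (allFin n))

annihilation : ∀ {n} → Graph n → ℕ
annihilation {n} G =
  maxℕ (filterᵇ (λ k → sum (take k (sortedDegrees G)) ≤ᵇ edgeCount G)
                (upTo (suc n)))

-- Let J be a critical independent set of maximum size. In a bipartite graph J ∪ N(J)
-- is the whole vertex set: otherwise let R be the larger colour class among the
-- vertices outside J ∪ N(J). The neighbours of R outside N(J) lie in the other,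
-- smaller class, so J ∪ R is still critical, and larger than J.
--
-- Once J ∪ N(J) covers everything, criticality of J bounds every independent set S.
-- With P = S ∖ J and K = J ∩ N(P), the exchange J′ = (J ∖ K) ∪ P is independent,
-- contains S, and its surplus |J′| − |N(J′)| is at least that of J plus 2(|P| − |K|).
-- Hence |P| ≤ |K| and |S| ≤ |J′| ≤ |J|.
module Submission where

open import Defs
open import Data.Bool as Bool using (Bool; true; false; not; T; _∧_)
open import Data.Bool.Properties using (T-≡; T-∧; not-¬; not-involutive)
open import Data.Bool.ListAction using (all; any)
open import Data.Empty using (⊥-elim)
open import Data.Fin using (Fin)
open import Data.Fin.Subset
open import Data.Fin.Subset.Properties
open import Data.Integer as ℤ using (0ℤ; _⊖_)
open import Data.Integer.Properties as ℤ using (+-cancelˡ-⊖; ⊖-monoˡ-≤; ⊖-monoˡ-<; [+m]-[+n]≡m⊖n)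
open import Data.List using (map; filterᵇ; allFin)
open import Data.List.Properties using (foldr-forcesᵇ; foldr-preservesᵇ)
import Data.List.Membership.Propositional as List
open import Data.List.Membership.Propositional using (lose)
open import Data.List.Membership.Propositional.Properties
  using (∈-allFin; ∈-filter⁺; ∈-filter⁻; ∈-map⁺; ∈-map⁻; ∈-++⁺ˡ; ∈-++⁺ʳ; foldr-selective)
import Data.List.Relation.Unary.All as All
open import Data.List.Relation.Unary.All.Properties using (all⁺; all⁻)
import Data.List.Relation.Unary.Any as Any
open import Data.List.Relation.Unary.Any.Properties using (any⁺; any⁻)
open import Data.Nat using (ℕ; suc; _+_; _≤_; _<_; z≤n)
open import Data.Nat.Properties
open import Data.Product using (_×_; _,_; proj₁; proj₂; ∃-syntax)
open import Data.Sum using (_⊎_; inj₁; inj₂; [_,_]′)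
open import Data.Vec using (_∷_; []; lookup; tabulate; there)
open import Data.Vec.Properties using ([]=⇒lookup; lookup⇒[]=; lookup∘tabulate)
open import Function using (_∘_)
open import Function.Bundles using (_⇔_; mk⇔; Equivalence)
open import Relation.Binary.PropositionalEquality as ≡ using (_≡_; refl; cong; subst)
open import Relation.Nullary using (¬_; yes; no)
open import Relation.Nullary.Decidable using (⌊_⌋; T?; toWitness; fromWitness)

open Equivalence using (to; from)

T-not⇔¬T : ∀ {b} → T (not b) ⇔ (¬ T b)
T-not⇔¬T {true}  = mk⇔ (λ ()) (λ ¬t → ¬t _)
T-not⇔¬T {false} = mk⇔ (λ _ ()) (λ _ → _)

T-all-allFin : ∀ {n} (p : Fin n → Bool) → T (all p (allFin n)) ⇔ (∀ i → T (p i))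
T-all-allFin p = mk⇔
  (λ h i → All.lookup (all⁺ p _ h) (∈-allFin i))
  (λ h → all⁻ p {allFin _} (All.tabulate λ {i} _ → h i))

T-any-allFin : ∀ {n} (p : Fin n → Bool) → T (any p (allFin n)) ⇔ (∃[ i ] T (p i))
T-any-allFin p = mk⇔
  (Any.satisfied ∘ any⁻ p (allFin _))
  (λ (i , pi) → any⁺ p (lose {xs = allFin _} (∈-allFin i) pi))

∈⇔T-lookup : ∀ {n} {x : Fin n} {p : Subset n} → x ∈ p ⇔ T (lookup p x)
∈⇔T-lookup = mk⇔ (λ x∈p → from T-≡ ([]=⇒lookup x∈p)) (λ t → lookup⇒[]= _ _ (to T-≡ t))

∈-tabulate⇔ : ∀ {n} {x : Fin n} (f : Fin n → Bool) → x ∈ tabulate f ⇔ T (f x)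
∈-tabulate⇔ {x = x} f rewrite ≡.sym (lookup∘tabulate f x) = ∈⇔T-lookup

x∈p─q⇒x∉q : ∀ {n} {x : Fin n} (p q : Subset n) → x ∈ p ─ q → x ∉ q
x∈p─q⇒x∉q (_ ∷ p) (_ ∷ q) (there x∈p─q) (there x∈q) = x∈p─q⇒x∉q p q x∈p─q x∈q

colourClass : ∀ {n} → (Fin n → Bool) → Bool → Subset n
colourClass c b = tabulate λ v → ⌊ c v Bool.≟ b ⌋

∈-colourClass : ∀ {n} {v : Fin n} {b} (c : Fin n → Bool) → v ∈ colourClass c b ⇔ c v ≡ b
∈-colourClass c = mk⇔ (toWitness ∘ to (∈-tabulate⇔ _)) (from (∈-tabulate⇔ _) ∘ fromWitness)

∣p∪q∣+∣p∩q∣≡∣p∣+∣q∣ : ∀ {n} (p q : Subset n) → ∣ p ∪ q ∣ + ∣ p ∩ q ∣ ≡ ∣ p ∣ + ∣ q ∣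
∣p∪q∣+∣p∩q∣≡∣p∣+∣q∣ []          []          = refl
∣p∪q∣+∣p∩q∣≡∣p∣+∣q∣ (false ∷ p) (false ∷ q) = ∣p∪q∣+∣p∩q∣≡∣p∣+∣q∣ p q
∣p∪q∣+∣p∩q∣≡∣p∣+∣q∣ (true  ∷ p) (false ∷ q) = cong suc (∣p∪q∣+∣p∩q∣≡∣p∣+∣q∣ p q)
∣p∪q∣+∣p∩q∣≡∣p∣+∣q∣ (false ∷ p) (true  ∷ q) =
  ≡.trans (cong suc (∣p∪q∣+∣p∩q∣≡∣p∣+∣q∣ p q)) (≡.sym (+-suc ∣ p ∣ ∣ q ∣))
∣p∪q∣+∣p∩q∣≡∣p∣+∣q∣ (true  ∷ p) (true  ∷ q) =
  cong suc (≡.trans (+-suc ∣ p ∪ q ∣ ∣ p ∩ q ∣)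
    (≡.trans (cong suc (∣p∪q∣+∣p∩q∣≡∣p∣+∣q∣ p q)) (≡.sym (+-suc ∣ p ∣ ∣ q ∣))))

∣p∪q∣≤∣p∣+∣q∣ : ∀ {n} (p q : Subset n) → ∣ p ∪ q ∣ ≤ ∣ p ∣ + ∣ q ∣
∣p∪q∣≤∣p∣+∣q∣ p q = ≤-trans (m≤m+n ∣ p ∪ q ∣ ∣ p ∩ q ∣) (≤-reflexive (∣p∪q∣+∣p∩q∣≡∣p∣+∣q∣ p q))

r⊆p∪q⇒∣r∣≤∣p∣+∣q∣ : ∀ {n} {p q r : Subset n} → r ⊆ p ∪ q → ∣ r ∣ ≤ ∣ p ∣ + ∣ q ∣
r⊆p∪q⇒∣r∣≤∣p∣+∣q∣ {p = p} {q} r⊆p∪q = ≤-trans (p⊆q⇒∣p∣≤∣q∣ r⊆p∪q) (∣p∪q∣≤∣p∣+∣q∣ p q)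

disjoint⇒∣p∣+∣q∣≤∣p∪q∣ : ∀ {n} {p q : Subset n} → (∀ {x} → x ∈ p → x ∉ q) →
                        ∣ p ∣ + ∣ q ∣ ≤ ∣ p ∪ q ∣
disjoint⇒∣p∣+∣q∣≤∣p∪q∣ {n} {p} {q} disjoint = begin
  ∣ p ∣ + ∣ q ∣           ≡⟨ ∣p∪q∣+∣p∩q∣≡∣p∣+∣q∣ p q ⟨
  ∣ p ∪ q ∣ + ∣ p ∩ q ∣   ≡⟨ cong (λ s → ∣ p ∪ q ∣ + ∣ s ∣) (Empty-unique p∩q-empty) ⟩
  ∣ p ∪ q ∣ + ∣ ⊥ {n} ∣   ≡⟨ cong (∣ p ∪ q ∣ +_) (∣⊥∣≡0 n) ⟩
  ∣ p ∪ q ∣ + 0           ≡⟨ +-identityʳ _ ⟩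
  ∣ p ∪ q ∣               ∎
  where
  open ≤-Reasoning
  p∩q-empty : Empty (p ∩ q)
  p∩q-empty (x , x∈p∩q) = let x∈p , x∈q = x∈p∩q⁻ p q x∈p∩q in disjoint x∈p x∈q

disjoint-⊆⇒∣p∣+∣q∣≤∣r∣ : ∀ {n} {p q r : Subset n} → (∀ {x} → x ∈ p → x ∉ q) →
                        p ⊆ r → q ⊆ r → ∣ p ∣ + ∣ q ∣ ≤ ∣ r ∣
disjoint-⊆⇒∣p∣+∣q∣≤∣r∣ {p = p} {q} disjoint p⊆r q⊆r =
  ≤-trans (disjoint⇒∣p∣+∣q∣≤∣p∪q∣ disjoint)
          (p⊆q⇒∣p∣≤∣q∣ λ x∈p∪q → [ p⊆r , q⊆r ]′ (x∈p∪q⁻ p q x∈p∪q))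

⊖-cancelʳ : ∀ m n o → (m + o) ⊖ (n + o) ≡ m ⊖ n
⊖-cancelʳ m n o rewrite +-comm m o | +-comm n o = +-cancelˡ-⊖ o m n

⊖-cancelʳ-≤ : ∀ {m n} o → m ⊖ o ℤ.≤ n ⊖ o → m ≤ n
⊖-cancelʳ-≤ o m⊖o≤n⊖o = ≮⇒≥ λ n<m → ℤ.<⇒≱ (⊖-monoˡ-< o n<m) m⊖o≤n⊖o

m⊖n≤o⊖p⇔m+p≤o+n : ∀ m n o p → (m ⊖ n ℤ.≤ o ⊖ p) ⇔ (m + p ≤ o + n)
m⊖n≤o⊖p⇔m+p≤o+n m n o p
  rewrite ≡.sym (⊖-cancelʳ m n p) | ≡.sym (⊖-cancelʳ o p n) | +-comm p n =
  mk⇔ (⊖-cancelʳ-≤ (n + p)) (⊖-monoˡ-≤ (n + p))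

+-cancel-twice : ∀ {a b m n} → (a + m) + (b + m) ≤ (a + n) + (b + n) → m ≤ n
+-cancel-twice {a} {b} h = ≮⇒≥ λ n<m → <⇒≱ (+-mono-< (+-monoʳ-< a n<m) (+-monoʳ-< b n<m)) h

maxℕ-upper : ∀ ms → All.All (_≤ maxℕ ms) ms
maxℕ-upper ms = foldr-forcesᵇ (λ x y x⊔y≤ → m⊔n≤o⇒m≤o x y x⊔y≤ , m⊔n≤o⇒n≤o x y x⊔y≤) 0 ms ≤-refl

maxℕ-least : ∀ {m ms} → All.All (_≤ m) ms → maxℕ ms ≤ m
maxℕ-least = foldr-preservesᵇ ⊔-lub z≤n

maxℕ-attained : ∀ {m ms} → m List.∈ ms → maxℕ ms List.∈ ms
maxℕ-attained {m} {ms} m∈ms with foldr-selective ⊔-sel 0 ms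
... | inj₂ max∈ms = max∈ms
... | inj₁ max≡0  = subst (List._∈ ms) (≡.trans m≡0 (≡.sym max≡0)) m∈ms
  where
  m≡0 : m ≡ 0
  m≡0 = n≤0⇒n≡0 (subst (m ≤_) max≡0 (All.lookup (maxℕ-upper ms) m∈ms))

∈-allSubsets : ∀ {n} (S : Subset n) → S List.∈ allSubsets n
∈-allSubsets []          = Any.here refl
∈-allSubsets (true  ∷ S) = ∈-++⁺ˡ (∈-map⁺ (true ∷_) (∈-allSubsets S))
∈-allSubsets (false ∷ S) = ∈-++⁺ʳ _ (∈-map⁺ (false ∷_) (∈-allSubsets S))

module _ {n : ℕ} (p : Subset n → Bool) where

  maxSize : ℕ
  maxSize = maxℕ (map ∣_∣ (filterᵇ p (allSubsets n)))

  ∈-satisfying : ∀ S → T (p S) → S List.∈ filterᵇ p (allSubsets n)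
  ∈-satisfying S = ∈-filter⁺ (T? ∘ p) (∈-allSubsets S)

  satisfying-∈ : ∀ {S} → S List.∈ filterᵇ p (allSubsets n) → T (p S)
  satisfying-∈ S∈ = proj₂ (∈-filter⁻ (T? ∘ p) {xs = allSubsets n} S∈)

  ≤-maxSize : ∀ S → T (p S) → ∣ S ∣ ≤ maxSize
  ≤-maxSize S pS = All.lookup (maxℕ-upper _) (∈-map⁺ ∣_∣ (∈-satisfying S pS))

  maxSize-least : ∀ {m} → (∀ {S} → T (p S) → ∣ S ∣ ≤ m) → maxSize ≤ m
  maxSize-least {m} bound = maxℕ-least (All.tabulate size≤)
    where
    size≤ : ∀ {k} → k List.∈ map ∣_∣ (filterᵇ p (allSubsets n)) → k ≤ m
    size≤ k∈ with ∈-map⁻ ∣_∣ k∈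
    ... | S , S∈ , refl = bound (satisfying-∈ S∈)

  maxSize-attained : ∀ S → T (p S) → ∃[ J ] T (p J) × ∣ J ∣ ≡ maxSize
  maxSize-attained S pS with ∈-map⁻ ∣_∣ (maxℕ-attained (∈-map⁺ ∣_∣ (∈-satisfying S pS)))
  ... | J , J∈ , max≡∣J∣ = J , satisfying-∈ J∈ , ≡.sym max≡∣J∣

module _ {n : ℕ} (G : Graph n) where

  infix 4 _~_
  _~_ : Fin n → Fin n → Set
  u ~ v = T (adj G u v)

  ~-sym : ∀ {u v} → u ~ v → v ~ u
  ~-sym {u} {v} = subst T (sym G u v)

  Independent : Subset n → Set
  Independent I = ∀ {u v} → u ∈ I → v ∈ I → ¬ u ~ v

  isIndependent⇔Independent : ∀ I → T (isIndependent G I) ⇔ Independent I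
  isIndependent⇔Independent I = mk⇔
    (λ h {u} {v} u∈I v∈I u~v →
       to T-not⇔¬T (to (T-all-allFin (nonEdge u)) (to (T-all-allFin row) h u) v)
         (from T-∧ (to ∈⇔T-lookup u∈I , from T-∧ (to ∈⇔T-lookup v∈I , u~v))))
    (λ I-ind → from (T-all-allFin row) λ u → from (T-all-allFin (nonEdge u)) λ v →
       from T-not⇔¬T λ t →
         let tu , tv∧u~v = to T-∧ t ; tv , u~v = to T-∧ tv∧u~v
         in I-ind (from ∈⇔T-lookup tu) (from ∈⇔T-lookup tv) u~v)
    where
    nonEdge : Fin n → Fin n → Bool
    nonEdge u v = not (lookup I u ∧ lookup I v ∧ adj G u v)
    row : Fin n → Bool
    row u = all (nonEdge u) (allFin n)

  ∈-nbhd⇔ : ∀ {S v} → v ∈ nbhd G S ⇔ (∃[ u ] u ∈ S × u ~ v)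
  ∈-nbhd⇔ = mk⇔
    (λ v∈NS → let u , t = to (T-any-allFin _) (to (∈-tabulate⇔ _) v∈NS) ; tu , u~v = to T-∧ t
              in u , from ∈⇔T-lookup tu , u~v)
    (λ (u , u∈S , u~v) →
       from (∈-tabulate⇔ _) (from (T-any-allFin _) (u , from T-∧ (to ∈⇔T-lookup u∈S , u~v))))

  diff≡⊖ : ∀ S → diff G S ≡ ∣ S ∣ ⊖ ∣ nbhd G S ∣
  diff≡⊖ S = [+m]-[+n]≡m⊖n (∣ S ∣) (∣ nbhd G S ∣)

  diff-≤⇔ : ∀ S S′ → (diff G S ℤ.≤ diff G S′) ⇔ (∣ S ∣ + ∣ nbhd G S′ ∣ ≤ ∣ S′ ∣ + ∣ nbhd G S ∣)
  diff-≤⇔ S S′ rewrite diff≡⊖ S | diff≡⊖ S′ =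
    m⊖n≤o⊖p⇔m+p≤o+n (∣ S ∣) (∣ nbhd G S ∣) (∣ S′ ∣) (∣ nbhd G S′ ∣)

  Critical : Subset n → Set
  Critical J = Independent J × (∀ {I} → Independent I → diff G I ℤ.≤ diff G J)

  MaximumCritical : Subset n → Set
  MaximumCritical J = Critical J × (∀ {S} → Critical S → ∣ S ∣ ≤ ∣ J ∣)

  diff-≥-critical : ∀ {J S} → Critical J → Independent S → diff G J ℤ.≤ diff G S → Critical S
  diff-≥-critical (_ , J-crit) S-ind J≤S = S-ind , λ I-ind → ℤ.≤-trans (J-crit I-ind) J≤S

  module Exchange {J S : Subset n} (J-ind : Independent J) (S-ind : Independent S)
                  (covers : ∀ v → v ∈ J ⊎ v ∈ nbhd G J) where

    P A K R J′ : Subset n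
    P  = S ─ J
    A  = J ─ nbhd G P
    K  = J ∩ nbhd G P
    R  = nbhd G J ─ P
    J′ = A ∪ P

    P⊆S : P ⊆ S
    P⊆S = p─q⊆p S J

    A⊆J : A ⊆ J
    A⊆J = p─q⊆p J (nbhd G P)

    A∌NP : ∀ {v} → v ∈ A → v ∉ nbhd G P
    A∌NP = x∈p─q⇒x∉q J (nbhd G P)

    A∩P≡∅ : ∀ {v} → v ∈ A → v ∉ P
    A∩P≡∅ v∈A v∈P = x∈p─q⇒x∉q S J v∈P (A⊆J v∈A)

    A∩K≡∅ : ∀ {v} → v ∈ A → v ∉ K
    A∩K≡∅ v∈A v∈K = A∌NP v∈A (proj₂ (x∈p∩q⁻ J _ v∈K))

    S⊆J′ : S ⊆ J′
    S⊆J′ {v} v∈S with v ∈? J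
    ... | no  v∉J = x∈p∪q⁺ (inj₂ (x∈p∧x∉q⇒x∈p─q v∈S v∉J))
    ... | yes v∈J = x∈p∪q⁺ (inj₁ (x∈p∧x∉q⇒x∈p─q v∈J λ v∈NP →
            let u , u∈P , u~v = to ∈-nbhd⇔ v∈NP in S-ind (P⊆S u∈P) v∈S u~v))

    J′-ind : Independent J′
    J′-ind {u} {v} u∈J′ v∈J′ u~v with x∈p∪q⁻ A P u∈J′ | x∈p∪q⁻ A P v∈J′
    ... | inj₁ u∈A | inj₁ v∈A = J-ind (A⊆J u∈A) (A⊆J v∈A) u~v
    ... | inj₁ u∈A | inj₂ v∈P = A∌NP u∈A (from ∈-nbhd⇔ (v , v∈P , ~-sym u~v))
    ... | inj₂ u∈P | inj₁ v∈A = A∌NP v∈A (from ∈-nbhd⇔ (u , u∈P , u~v))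
    ... | inj₂ u∈P | inj₂ v∈P = S-ind (P⊆S u∈P) (P⊆S v∈P) u~v

    J⊆A∪K : J ⊆ A ∪ K
    J⊆A∪K {v} v∈J with v ∈? nbhd G P
    ... | yes v∈NP = x∈p∪q⁺ (inj₂ (x∈p∩q⁺ (v∈J , v∈NP)))
    ... | no  v∉NP = x∈p∪q⁺ (inj₁ (x∈p∧x∉q⇒x∈p─q v∈J v∉NP))

    P⊆NJ : P ⊆ nbhd G J
    P⊆NJ {v} v∈P = [ (λ v∈J → ⊥-elim (x∈p─q⇒x∉q S J v∈P v∈J)) , (λ v∈NJ → v∈NJ) ]′ (covers v)

    NJ′⊆R∪K : nbhd G J′ ⊆ R ∪ K
    NJ′⊆R∪K {w} w∈NJ′ with to ∈-nbhd⇔ w∈NJ′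
    ... | u , u∈J′ , u~w with x∈p∪q⁻ A P u∈J′
    ...   | inj₁ u∈A = x∈p∪q⁺ (inj₁ (x∈p∧x∉q⇒x∈p─q (from ∈-nbhd⇔ (u , A⊆J u∈A , u~w)) λ w∈P →
              A∌NP u∈A (from ∈-nbhd⇔ (w , w∈P , ~-sym u~w))))
    ...   | inj₂ u∈P with covers w
    ...     | inj₁ w∈J  = x∈p∪q⁺ (inj₂ (x∈p∩q⁺ (w∈J , from ∈-nbhd⇔ (u , u∈P , u~w))))
    ...     | inj₂ w∈NJ = x∈p∪q⁺ (inj₁ (x∈p∧x∉q⇒x∈p─q w∈NJ λ w∈P →
              S-ind (P⊆S u∈P) (P⊆S w∈P) u~w))

  critical-covering-dominates : ∀ {J S} → Critical J → (∀ v → v ∈ J ⊎ v ∈ nbhd G J) →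
                                Independent S → ∣ S ∣ ≤ ∣ J ∣
  critical-covering-dominates {J} {S} (J-ind , J-crit) covers S-ind = begin
    ∣ S ∣          ≤⟨ p⊆q⇒∣p∣≤∣q∣ S⊆J′ ⟩
    ∣ J′ ∣         ≤⟨ ∣p∪q∣≤∣p∣+∣q∣ A P ⟩
    ∣ A ∣ + ∣ P ∣  ≤⟨ +-monoʳ-≤ ∣ A ∣ ∣P∣≤∣K∣ ⟩
    ∣ A ∣ + ∣ K ∣  ≤⟨ disjoint-⊆⇒∣p∣+∣q∣≤∣r∣ A∩K≡∅ A⊆J (p∩q⊆p J (nbhd G P)) ⟩
    ∣ J ∣          ∎
    where
    open Exchange J-ind S-ind covers
    open ≤-Reasoning

    ∣P∣≤∣K∣ : ∣ P ∣ ≤ ∣ K ∣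
    ∣P∣≤∣K∣ = +-cancel-twice {∣ A ∣} {∣ R ∣} (begin
      (∣ A ∣ + ∣ P ∣) + (∣ R ∣ + ∣ P ∣)
        ≤⟨ +-mono-≤ (disjoint⇒∣p∣+∣q∣≤∣p∪q∣ A∩P≡∅)
                    (disjoint-⊆⇒∣p∣+∣q∣≤∣r∣ (x∈p─q⇒x∉q (nbhd G J) P) (p─q⊆p (nbhd G J) P) P⊆NJ) ⟩
      ∣ J′ ∣ + ∣ nbhd G J ∣
        ≤⟨ to (diff-≤⇔ J′ J) (J-crit J′-ind) ⟩
      ∣ J ∣ + ∣ nbhd G J′ ∣
        ≤⟨ +-mono-≤ (r⊆p∪q⇒∣r∣≤∣p∣+∣q∣ J⊆A∪K) (r⊆p∪q⇒∣r∣≤∣p∣+∣q∣ NJ′⊆R∪K) ⟩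
      (∣ A ∣ + ∣ K ∣) + (∣ R ∣ + ∣ K ∣) ∎)

  maximumCritical-unextendable : ∀ {J R Q} → MaximumCritical J → Independent R →
    (∀ {v} → v ∈ R → v ∉ J ∪ nbhd G J) → nbhd G R ⊆ nbhd G J ∪ Q → ∣ Q ∣ ≤ ∣ R ∣ →
    ∣ R ∣ ≡ 0
  maximumCritical-unextendable {J} {R} {Q} (J-crit@(J-ind , _) , J-max) R-ind R-outside
                               NR⊆NJ∪Q ∣Q∣≤∣R∣ =
    n≤0⇒n≡0 (+-cancelˡ-≤ (∣ J ∣) _ _ (begin
      ∣ J ∣ + ∣ R ∣  ≡⟨ ∣J∣+∣R∣≡∣J∪R∣ ⟩
      ∣ J ∪ R ∣      ≤⟨ J-max (diff-≥-critical J-crit J∪R-ind J≤J∪R) ⟩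
      ∣ J ∣          ≡⟨ +-identityʳ (∣ J ∣) ⟨
      ∣ J ∣ + 0      ∎))
    where
    open ≤-Reasoning

    R∌NJ : ∀ {v} → v ∈ R → v ∉ nbhd G J
    R∌NJ v∈R v∈NJ = R-outside v∈R (x∈p∪q⁺ (inj₂ v∈NJ))

    ∣J∣+∣R∣≡∣J∪R∣ : ∣ J ∣ + ∣ R ∣ ≡ ∣ J ∪ R ∣
    ∣J∣+∣R∣≡∣J∪R∣ = ≤-antisym
      (disjoint⇒∣p∣+∣q∣≤∣p∪q∣ λ v∈J v∈R → R-outside v∈R (x∈p∪q⁺ (inj₁ v∈J)))
      (∣p∪q∣≤∣p∣+∣q∣ J R)

    J∪R-ind : Independent (J ∪ R)
    J∪R-ind u∈J∪R v∈J∪R u~v with x∈p∪q⁻ J R u∈J∪R | x∈p∪q⁻ J R v∈J∪R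
    ... | inj₁ u∈J | inj₁ v∈J = J-ind u∈J v∈J u~v
    ... | inj₁ u∈J | inj₂ v∈R = R∌NJ v∈R (from ∈-nbhd⇔ (_ , u∈J , u~v))
    ... | inj₂ u∈R | inj₁ v∈J = R∌NJ u∈R (from ∈-nbhd⇔ (_ , v∈J , ~-sym u~v))
    ... | inj₂ u∈R | inj₂ v∈R = R-ind u∈R v∈R u~v

    N[J∪R]⊆NJ∪Q : nbhd G (J ∪ R) ⊆ nbhd G J ∪ Q
    N[J∪R]⊆NJ∪Q w∈N with to ∈-nbhd⇔ w∈N
    ... | u , u∈J∪R , u~w with x∈p∪q⁻ J R u∈J∪R
    ...   | inj₁ u∈J = x∈p∪q⁺ (inj₁ (from ∈-nbhd⇔ (u , u∈J , u~w)))
    ...   | inj₂ u∈R = NR⊆NJ∪Q (from ∈-nbhd⇔ (u , u∈R , u~w))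

    J≤J∪R : diff G J ℤ.≤ diff G (J ∪ R)
    J≤J∪R = from (diff-≤⇔ J (J ∪ R)) (begin
      ∣ J ∣ + ∣ nbhd G (J ∪ R) ∣       ≤⟨ +-monoʳ-≤ (∣ J ∣) (r⊆p∪q⇒∣r∣≤∣p∣+∣q∣ N[J∪R]⊆NJ∪Q) ⟩
      ∣ J ∣ + (∣ nbhd G J ∣ + ∣ Q ∣)  ≤⟨ +-monoʳ-≤ (∣ J ∣) (+-monoʳ-≤ (∣ nbhd G J ∣) ∣Q∣≤∣R∣) ⟩
      ∣ J ∣ + (∣ nbhd G J ∣ + ∣ R ∣)  ≡⟨ cong (∣ J ∣ +_) (+-comm (∣ nbhd G J ∣) (∣ R ∣)) ⟩
      ∣ J ∣ + (∣ R ∣ + ∣ nbhd G J ∣)  ≡⟨ +-assoc (∣ J ∣) (∣ R ∣) (∣ nbhd G J ∣) ⟨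
      ∣ J ∣ + ∣ R ∣ + ∣ nbhd G J ∣    ≡⟨ cong (_+ ∣ nbhd G J ∣) ∣J∣+∣R∣≡∣J∪R∣ ⟩
      ∣ J ∪ R ∣ + ∣ nbhd G J ∣        ∎)

  module _ (c : Fin n → Bool) (proper : ∀ u v → adj G u v ≡ true → c u ≡ not (c v))
           {J : Subset n} (J-max : MaximumCritical J) where

    private
      U : Bool → Subset n
      U b = colourClass c b ─ (J ∪ nbhd G J)

      colour-U : ∀ {v b} → v ∈ U b → c v ≡ b
      colour-U {b = b} v∈U = to (∈-colourClass c) (p─q⊆p (colourClass c b) _ v∈U)

      U∌J∪NJ : ∀ {v b} → v ∈ U b → v ∉ J ∪ nbhd G J
      U∌J∪NJ {b = b} = x∈p─q⇒x∉q (colourClass c b) (J ∪ nbhd G J)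

      proper~ : ∀ {u v} → u ~ v → c u ≡ not (c v)
      proper~ {u} {v} u~v = proper u v (to T-≡ u~v)

      U-ind : ∀ b → Independent (U b)
      U-ind b u∈U v∈U u~v =
        not-¬ refl (≡.trans (≡.sym (colour-U u∈U)) (≡.trans (proper~ u~v) (cong not (colour-U v∈U))))

      NU⊆NJ∪U : ∀ b → nbhd G (U b) ⊆ nbhd G J ∪ U (not b)
      NU⊆NJ∪U b {w} w∈NU with to ∈-nbhd⇔ w∈NU | w ∈? nbhd G J
      ... | _             | yes w∈NJ = x∈p∪q⁺ (inj₁ w∈NJ)
      ... | u , u∈U , u~w | no  w∉NJ =
        x∈p∪q⁺ (inj₂ (x∈p∧x∉q⇒x∈p─q (from (∈-colourClass c) colour-w) w∉J∪NJ))
        where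
        colour-w : c w ≡ not b
        colour-w = ≡.trans (proper~ (~-sym u~w)) (cong not (colour-U u∈U))
        w∉J : w ∉ J
        w∉J w∈J = U∌J∪NJ u∈U (x∈p∪q⁺ (inj₂ (from ∈-nbhd⇔ (w , w∈J , ~-sym u~w))))
        w∉J∪NJ : w ∉ J ∪ nbhd G J
        w∉J∪NJ w∈J∪NJ = [ w∉J , w∉NJ ]′ (x∈p∪q⁻ J _ w∈J∪NJ)

      U-empty-if-larger : ∀ b → ∣ U (not b) ∣ ≤ ∣ U b ∣ → ∣ U b ∣ ≡ 0
      U-empty-if-larger b = maximumCritical-unextendable J-max (U-ind b) U∌J∪NJ (NU⊆NJ∪U b)

      U-empty : ∀ b → ∣ U b ∣ ≡ 0
      U-empty b with ≤-total ∣ U (not b) ∣ ∣ U b ∣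
      ... | inj₁ ≤ = U-empty-if-larger b ≤
      ... | inj₂ ≥ = n≤0⇒n≡0 (subst (∣ U b ∣ ≤_) (U-empty-if-larger (not b) ≥′) ≥)
        where
        ≥′ : ∣ U (not (not b)) ∣ ≤ ∣ U (not b) ∣
        ≥′ rewrite not-involutive b = ≥

    bipartite-maximumCritical-covers : ∀ v → v ∈ J ⊎ v ∈ nbhd G J
    bipartite-maximumCritical-covers v with v ∈? J ∪ nbhd G J
    ... | yes v∈J∪NJ = x∈p∪q⁻ J _ v∈J∪NJ
    ... | no  v∉J∪NJ = ⊥-elim (n≮0 (subst (∣ U (c v) - v ∣ <_) (U-empty (c v)) (x∈p⇒∣p-x∣<∣p∣ v∈U)))
      where
      v∈U : v ∈ U (c v)
      v∈U = x∈p∧x∉q⇒x∈p─q (from (∈-colourClass c) refl) v∉J∪NJ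

  diff≤maxDiff : ∀ {I} → Independent I → diff G I ℤ.≤ maxDiff G
  diff≤maxDiff {I} I-ind = All.lookup diffs≤maxDiff
    (∈-map⁺ (diff G) (∈-satisfying (isIndependent G) I (from (isIndependent⇔Independent I) I-ind)))
    where
    diffs≤maxDiff : All.All (ℤ._≤ maxDiff G) (map (diff G) (independentSets G))
    diffs≤maxDiff = foldr-forcesᵇ (λ i j i⊔j≤ → ℤ.i⊔j≤k⇒i≤k i j i⊔j≤ , ℤ.i⊔j≤k⇒j≤k i j i⊔j≤)
                                  0ℤ _ ℤ.≤-refl

  maxDiff-attained : ∃[ I ] Independent I × diff G I ≡ maxDiff G
  maxDiff-attained with foldr-selective ℤ.⊔-sel 0ℤ (map (diff G) (independentSets G))
  ... | inj₁ max≡0 = ⊥ , (λ u∈⊥ → ⊥-elim (∉⊥ u∈⊥)) , ≡.trans diff⊥≡0 (≡.sym max≡0)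
    where
    N⊥⊆⊥ : nbhd G ⊥ ⊆ ⊥
    N⊥⊆⊥ v∈N⊥ = let u , u∈⊥ , _ = to ∈-nbhd⇔ v∈N⊥ in ⊥-elim (∉⊥ u∈⊥)
    ∣N⊥∣≡0 : ∣ nbhd G ⊥ ∣ ≡ 0
    ∣N⊥∣≡0 = n≤0⇒n≡0 (≤-trans (p⊆q⇒∣p∣≤∣q∣ N⊥⊆⊥) (≤-reflexive (∣⊥∣≡0 n)))
    diff⊥≡0 : diff G ⊥ ≡ 0ℤ
    diff⊥≡0 rewrite ∣⊥∣≡0 n | ∣N⊥∣≡0 = refl
  ... | inj₂ max∈ with ∈-map⁻ (diff G) max∈
  ...   | I , I∈ , max≡ =
    I , to (isIndependent⇔Independent I) (satisfying-∈ (isIndependent G) I∈) , ≡.sym max≡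

  isCritical⇔Critical : ∀ J → T (isCritical G J) ⇔ Critical J
  isCritical⇔Critical J = mk⇔ sound complete
    where
    sound : T (isCritical G J) → Critical J
    sound t = to (isIndependent⇔Independent J) J-ind , λ {I} I-ind →
                subst (diff G I ℤ.≤_) (≡.sym (toWitness diff≡max)) (diff≤maxDiff I-ind)
      where
      J-ind : T (isIndependent G J)
      J-ind = proj₁ (to T-∧ t)
      diff≡max : T ⌊ diff G J ℤ.≟ maxDiff G ⌋
      diff≡max = proj₂ (to T-∧ t)

    complete : Critical J → T (isCritical G J)
    complete (J-ind , J-crit) = from T-∧ (from (isIndependent⇔Independent J) J-ind ,
                                          fromWitness (ℤ.≤-antisym (diff≤maxDiff J-ind) max≤))
      where
      max≤ : maxDiff G ℤ.≤ diff G J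
      max≤ = let I , I-ind , diff≡max = maxDiff-attained in
             subst (ℤ._≤ diff G J) diff≡max (J-crit I-ind)

  critical-exists : ∃[ I ] Critical I
  critical-exists = let I , I-ind , diff≡max = maxDiff-attained in
    I , I-ind , λ {I′} I′-ind → subst (diff G I′ ℤ.≤_) (≡.sym diff≡max) (diff≤maxDiff I′-ind)

  maximumCritical-exists : ∃[ J ] MaximumCritical J × ∣ J ∣ ≡ α′ G
  maximumCritical-exists with critical-exists
  ... | I , I-crit with maxSize-attained (isCritical G) I (from (isCritical⇔Critical I) I-crit)
  ...   | J , J-crit , ∣J∣≡α′ = J , (to (isCritical⇔Critical J) J-crit , maximum) , ∣J∣≡α′
    where
    maximum : ∀ {S} → Critical S → ∣ S ∣ ≤ ∣ J ∣
    maximum {S} S-crit = subst (∣ S ∣ ≤_) (≡.sym ∣J∣≡α′)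
                           (≤-maxSize (isCritical G) S (from (isCritical⇔Critical S) S-crit))

α′≤α : ∀ {n} (G : Graph n) → α′ G ≤ α G
α′≤α G = maxSize-least (isCritical G) λ {S} t → ≤-maxSize (isIndependent G) S
  (from (isIndependent⇔Independent G S) (proj₁ (to (isCritical⇔Critical G S) t)))

bipartite⇒α≤α′ : ∀ {n} (G : Graph n) → Bipartite G → α G ≤ α′ G
bipartite⇒α≤α′ {n} G (c , proper) = maxSize-least (isIndependent G) λ {S} t →
  subst (∣ S ∣ ≤_) ∣J∣≡α′ (critical-covering-dominates G {J} {S} (proj₁ J-max) covers
                                                     (to (isIndependent⇔Independent G S) t))
  where
  J : Subset n
  J = proj₁ (maximumCritical-exists G)
  J-max : MaximumCritical G J
  J-max = proj₁ (proj₂ (maximumCritical-exists G))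
  ∣J∣≡α′ : ∣ J ∣ ≡ α′ G
  ∣J∣≡α′ = proj₂ (proj₂ (maximumCritical-exists G))

  covers : ∀ v → v ∈ J ⊎ v ∈ nbhd G J
  covers = bipartite-maximumCritical-covers G c proper {J} J-max

theorem5 : ∀ {n : ℕ} (G : Graph n) → Bipartite G →
    (α G ≡ annihilation G) ⇔ (α′ G ≡ annihilation G)
theorem5 G bipartite = mk⇔ (≡.trans (≡.sym α≡α′)) (≡.trans α≡α′)
  where
  α≡α′ : α G ≡ α′ G
  α≡α′ = ≤-antisym (bipartite⇒α≤α′ G bipartite) (α′≤α G)
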